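{- Let $F=F_{[a_1,b_1]}\cdots F_{[a_m,b_m]}$ be a star network of order $n$ with interior vertices $x_1,\dots,x_m$, let $v\in\mathfrak S_n$, $\pi\in\Pi_v(F)$ and $k\in[m]$. Then there exists $\sigma\in\Pi_v(F)$ such that (1) for each $p>k$, $\{(i,j): (\sigma_i,\sigma_j,p)\text{ is a defect}\}=\{(i,j):(\pi_i,\pi_j,p)\text{ is a defect}\}$, and (2) $\sigma$ has no defect at $x_k$, i.e. there is no pair $(i,j)$ with $(\sigma_i,\sigma_j,k)$ a defect.
   Context: A planar network of order $n$ is a directed, planar, acyclic multigraph embedded in the plane with $n$ source vertices on the left and $n$ sink vertices on the right, each labeled $1,\dots,n$ from bottom to top; edges may carry a positive integer multiplicity. For an interval $[a,b]\subseteq[n]$ (possibly empty), the simple star network $F_{[a,b]}$ has one interior vertex $x$, edges source $i\to x$ and $x\to$ sink $i$ for $i\in[a,b]$, and an edge source $i\to$ sink $i$ for $i\notin[a,b]$. The concatenation $E\circ F$ is obtained by deleting sink $i$ of $E$ and source $i$ of $F$ for each $i$ and merging each edge of $E$ ending at sink $i$ with each edge of $F$ starting at source $i$ into one edge. The condensed concatenation $E\bullet F$ is obtained from $E\circ F$ by replacing, for each pair of interior vertices joined by $p>1$ parallel edges, these edges by a single edge of multiplicity $p$. A star network $F=F_{[a_1,b_1]}\cdots F_{[a_m,b_m]}$ is any network built from $F_{[a_1,b_1]},\dots,F_{[a_m,b_m]}$ (in this order) by any combination of concatenations and condensed concatenations; its interior vertices are $x_1,\dots,x_m$, $x_j$ coming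 from $F_{[a_j,b_j]}$. A path family of type $v$ is a sequence $\pi=(\pi_1,\dots,\pi_n)$ of source-to-sink paths with $\pi_i$ from source $i$ to sink $v_i$; it covers $F$ if each edge of multiplicity $p$ lies on exactly $p$ of the paths; $\Pi_v(F)$ is the set of covering families of type $v$. The intersection of two paths has components that are single vertices or paths $(x_k,\dots,x_\ell)$; the two paths meet at the initial vertex $x_k$ of each component, and the component is a crossing if the paths enter $x_k$ and exit $x_\ell$ in different vertical orders. A defect of $\pi$ at $x_k$ is a triple $(\pi_i,\pi_j,k)$ with $i<j$ such that $\pi_i,\pi_j$ meet at $x_k$ after having crossed an odd number of times. -}

module Defs where

open import Data.Nat using (ℕ; _+_; _≤_; _<_; _≤ᵇ_; _<ᵇ_; _≡ᵇ_)
open import Data.Bool using (Bool; true; false; _∧_; _∨_; not; if_then_else_; T; _xor_)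
open import Data.Fin using (Fin; toℕ; splitAt; zero; suc)
open import Data.Fin.Permutation using (Permutation′; _⟨$⟩ʳ_)
open import Data.List using (List; []; _∷_; allFin)
open import Data.Maybe using (Maybe; just; nothing)
open import Data.Sum using (inj₁; inj₂)
open import Data.Product using (_×_; _,_)
open import Relation.Binary.PropositionalEquality using (_≡_)

-- Sources / sinks / horizontal "wires" labelled 1..n are represented by
-- Fin n (label = toℕ w + 1).  The interior vertex x_j (j = 1..m) is
-- represented by  int j  with j : Fin m (j ↦ toℕ j + 1); order of
-- interior vertices = order of Fin m.
-- An interval [a,b] is a pair of naturals; wire w lies in it iff
-- a ≤ toℕ w + 1 ≤ b  (empty when a > b).

IntervalIn : ℕ → ℕ → ℕ → Set
IntervalIn n a b = a ≤ b → (1 ≤ a) × (b ≤ n)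

-- How a star network F_[a1,b1] ... F_[am,bm] is built: a binary tree whose
-- leaves are the simple star networks F_[a1,b1],...,F_[am,bm] in this
-- order (left to right) and whose nodes are concatenations (false, ∘) or
-- condensed concatenations (true, •).

data Build : ℕ → Set where
  leaf : Build 1
  node : ∀ {p q} → Bool → Build p → Build q → Build (p + q)

-- Interior vertices x_j, x_j' end up joined by a single edge of
-- multiplicity p (instead of p parallel edges) iff the node of the tree at
-- which their edges are created (the node separating them) or some node
-- above it is a condensed concatenation.
condensed : ∀ {m} → Build m → Fin m → Fin m → Bool
condensed leaf _ _ = false
condensed (node {p} c l r) j j' with splitAt p j | splitAt p j'
... | inj₁ x | inj₁ y = c ∨ condensed l x y
... | inj₂ x | inj₂ y = c ∨ condensed r x y
... | _      | _      = c

data V (n m : ℕ) : Set where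
  src : Fin n → V n m
  int : Fin m → V n m
  snk : Fin n → V n m

_==F_ : ∀ {n} → Fin n → Fin n → Bool
x ==F y = toℕ x ≡ᵇ toℕ y

_==V_ : ∀ {n m} → V n m → V n m → Bool
src x ==V src y = x ==F y
int x ==V int y = x ==F y
snk x ==V snk y = x ==F y
_ ==V _ = false

-- A wire segment: its tail vertex and the wire (horizontal line) it is
-- drawn along.  Its head is computed from the network (see Net.head).
Seg : ℕ → ℕ → Set
Seg n m = V n m × Fin n

_==S_ : ∀ {n m} → Seg n m → Seg n m → Bool
(u , w) ==S (u' , w') = (u ==V u') ∧ (w ==F w')

memB : ∀ {n m} → Seg n m → List (Seg n m) → Bool
memB e [] = false
memB e (f ∷ fs) = (e ==S f) ∨ memB e fs

countB : ∀ {n} → (Fin n → Bool) → ℕ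
countB {ℕ.zero} f = 0
countB {ℕ.suc n} f = (if f zero then 1 else 0) + countB (λ i → f (suc i))

module Net {n m : ℕ} (a b : Fin m → ℕ) (B : Build m) where

  inI : Fin m → Fin n → Bool
  inI j w = (a j ≤ᵇ ℕ.suc (toℕ w)) ∧ (ℕ.suc (toℕ w) ≤ᵇ b j)

  nxt : ℕ → Fin n → V n m
  nxt s w = go (allFin m)
    where
    go : List (Fin m) → V n m
    go [] = snk w
    go (j ∷ js) = if (s ≤ᵇ toℕ j) ∧ inI j w then int j else go js

  through : V n m → Fin n → Bool
  through (src x) w = x ==F w
  through (int j) w = inI j w
  through (snk _) w = false

  head : Seg n m → V n m
  head (src _ , w) = nxt 0 w
  head (int j , w) = nxt (ℕ.suc (toℕ j)) w
  head (snk x , w) = snk x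

  condE : Seg n m → Bool
  condE (int j , w) with head (int j , w)
  ... | int j' = condensed B j j'
  ... | _      = false
  condE _ = false

  sameEnds : Seg n m → Fin n → Bool
  sameEnds (u , w) w' = through u w' ∧ (head (u , w') ==V head (u , w))

  allB : ℕ → (Fin n → Bool) → Bool
  allB k f = go (allFin n)
    where
    go : List (Fin n) → Bool
    go [] = true
    go (x ∷ xs) = (not (toℕ x <ᵇ k) ∨ f x) ∧ go xs

  -- Edges of the multigraph: a non-merged edge is its segment; a merged
  -- edge (multiplicity p) is represented by its lowest wire (and drawn
  -- along that wire in the planar embedding).
  IsEdge : Seg n m → Set
  IsEdge (u , w) = T (through u w ∧
    (not (condE (u , w)) ∨ allB (toℕ w) (λ w' → not (sameEnds (u , w) w'))))

  mult : Seg n m → ℕ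
  mult e = if condE e then countB (sameEnds e) else 1

  data PathFrom : V n m → Fin n → List (Seg n m) → Set where
    done : ∀ {t} → PathFrom (snk t) t []
    step : ∀ {u w t es} → IsEdge (u , w) → PathFrom (head (u , w)) t es →
           PathFrom u t ((u , w) ∷ es)

  -- π ∈ Π_v(F): π_i goes from source i to sink v(i), and every edge of
  -- multiplicity p lies on exactly p of the paths.
  InΠ : Permutation′ n → (Fin n → List (Seg n m)) → Set
  InΠ v π = (∀ i → PathFrom (src i) (v ⟨$⟩ʳ i) (π i))
          × (∀ e → IsEdge e → countB (λ i → memB e (π i)) ≡ mult e)

  visits : List (Seg n m) → List (Seg n m × Seg n m)
  visits (e ∷ f ∷ es) = (e , f) ∷ visits (f ∷ es)
  visits _ = []

  findV : V n m → List (Seg n m × Seg n m) → Maybe (Seg n m × Seg n m)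
  findV x [] = nothing
  findV x ((e , (u , w)) ∷ vs) = if u ==V x then just (e , (u , w)) else findV x vs

  -- common vertices of two paths, in order along the paths, with the
  -- in/out edges of each path: (vertex , in_p , out_p , in_q , out_q)
  Quad : Set
  Quad = V n m × Seg n m × Seg n m × Seg n m × Seg n m

  shared : List (Seg n m × Seg n m) → List (Seg n m × Seg n m) → List Quad
  shared [] vq = []
  shared ((ip , (u , w)) ∷ vp) vq with findV u vq
  ... | just (iq , oq) = (u , ip , (u , w) , iq , oq) ∷ shared vp vq
  ... | nothing        = shared vp vq

  wire : Seg n m → Fin n
  wire (_ , w) = w

  -- A component of the intersection
  -- begins at a common vertex where the two paths enter along different
  -- edges (the paths "meet" there) and ends at a common vertex where
  -- they leave along different edges; it is a crossing iff the vertical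
  -- order of the entering edges differs from that of the exiting edges.
  -- par = parity of the number of crossings completed so far,
  -- ent = "p enters the current component below q".
  -- Result: p and q meet at x_k after having crossed an odd number of times.
  scan : Bool → Bool → List Quad → Fin m → Bool
  scan par ent [] k = false
  scan par ent ((x , ip , op , iq , oq) ∷ rest) k =
    let meet   = not (ip ==S iq)
        ent'   = if meet then toℕ (wire ip) <ᵇ toℕ (wire iq) else ent
        here   = meet ∧ (x ==V int k) ∧ par
        leaves = not (op ==S oq)
        par'   = if leaves
                 then par xor (ent' xor (toℕ (wire op) <ᵇ toℕ (wire oq)))
                 else par
    in here ∨ scan par' ent' rest k

  Defect : (Fin n → List (Seg n m)) → Fin n → Fin n → Fin m → Set
  Defect π i j k = (toℕ i < toℕ j)
                 × T (scan false false (shared (visits (π i)) (visits (π j))) k)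

{-# OPTIONS --safe #-}
-- In a star network x_K occupies an interval of wires, so two paths can change
-- their vertical order only at a common vertex.  Scanning the common vertices
-- in order, the crossing parity of the defect definition therefore records
-- whether π_i currently runs above π_j, and for i < j a defect at x_k means
-- exactly that both paths pass x_k with π_j entering it below π_i.  Such an
-- inversion forces an earlier common vertex x_l, l < k.  Exchanging the
-- segments of π_i and π_j between x_l and x_k keeps every edge multiplicity
-- and everything after x_k, and swaps the wires on which they enter x_k.  This
-- strictly increases the weight Σ_h h · e_h, where e_h is 0 or one more than
-- the wire on which π_h enters x_k; the weight is at most n³, so finitely many
-- exchanges remove all defects at x_k.
module Submission where

open import Defs
open import Data.Bool using (Bool; true; false; _∧_; _∨_; not; if_then_else_; T; _xor_)
open import Data.Bool.Properties using (T-∧; T-∨; ∨-assoc)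
open import Data.Empty using (⊥-elim)
open import Data.Fin using (Fin; zero; suc; toℕ; punchIn; fromℕ<; _≟_; _<_)
open import Data.Fin.Permutation using (Permutation′; _⟨$⟩ʳ_)
open import Data.Fin.Properties using (toℕ-injective; toℕ<n; toℕ-fromℕ<; punchInᵢ≢i; any?)
open import Data.List using (List; []; _∷_; _++_; allFin; tabulate)
open import Data.List.Membership.Propositional using (_∈_)
open import Data.List.Relation.Unary.Any using (here; there)
open import Data.Maybe using (just; nothing)
open import Data.Nat using (ℕ; zero; suc; _+_; _*_; _∸_; _≤_; _≤ᵇ_; _<ᵇ_; z≤n; s≤s; z<s)
  renaming (_<_ to _<ℕ_)
open import Data.Nat.Properties hiding (_≟_)
open import Algebra.Properties.CommutativeMonoid.Sum +-0-commutativeMonoid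
  using (sum; sum-remove; sum-cong-≗)
open import Algebra.Properties.CommutativeSemigroup +-commutativeSemigroup using (xy∙z≈xz∙y; xy∙z≈zy∙x)
open import Data.Nat.Induction using (<-wellFounded)
open import Data.Nat.Solver using (module +-*-Solver)
open import Data.Product using (∃; ∃₂; _×_; _,_; proj₁; proj₂)
open import Data.Product.Function.NonDependent.Propositional using (_×-⇔_)
open import Data.Sum using (_⊎_; inj₁; inj₂)
open import Data.Sum.Function.Propositional using (_⊎-⇔_)
open import Function using (_∘_; _⇔_; mk⇔; Equivalence)
open import Function.Properties.Equivalence using () renaming (refl to ⇔-refl; trans to ⇔-trans; sym to ⇔-sym)
open import Induction.WellFounded using (Acc; acc)
open import Relation.Binary.PropositionalEquality
open import Relation.Binary.Definitions using (tri<; tri≈; tri>)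
open import Relation.Nullary using (¬_; Dec; yes; no; Reflects; ofʸ; ofⁿ; _×-dec_; map′)
open import Relation.Nullary.Negation using (contradiction)
open import Relation.Nullary.Reflects using (fromEquivalence; det; T-reflects; ¬-reflects; _×-reflects_)

open +-*-Solver using (solve; _:*_; _:+_; con; _:=_)

fromBool : Bool → ℕ
fromBool b = if b then 1 else 0

fromBool-∨ : ∀ x y → ¬ (T x × T y) → fromBool (x ∨ y) ≡ fromBool x + fromBool y
fromBool-∨ true  true  not-both = contradiction _ not-both
fromBool-∨ true  false _        = refl
fromBool-∨ false y     _        = refl

if-yes : ∀ {A P : Set} {c} {x y : A} → Reflects P c → P → (if c then x else y) ≡ x
if-yes (ofʸ _)  _ = refl
if-yes (ofⁿ ¬p) p = contradiction p ¬p

if-no : ∀ {A P : Set} {c} {x y : A} → Reflects P c → ¬ P → (if c then x else y) ≡ y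
if-no (ofʸ p) ¬p = contradiction p ¬p
if-no (ofⁿ _) _  = refl

T⇔ : ∀ {P : Set} {b} → Reflects P b → T b ⇔ P
T⇔ (ofʸ p)  = mk⇔ (λ _ → p) (λ _ → _)
T⇔ (ofⁿ ¬p) = mk⇔ (λ ()) ¬p

countB≡sum : ∀ {k} (f : Fin k → Bool) → countB f ≡ sum (fromBool ∘ f)
countB≡sum {zero}  f = refl
countB≡sum {suc k} f = cong (fromBool (f zero) +_) (countB≡sum (f ∘ suc))

sum-≤ : ∀ {k c} (f : Fin k → ℕ) → (∀ h → f h ≤ c) → sum f ≤ k * c
sum-≤ {zero}  f f≤c = z≤n
sum-≤ {suc k} f f≤c = +-mono-≤ (f≤c zero) (sum-≤ (f ∘ suc) (f≤c ∘ suc))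

sum-update : ∀ {k} (f g : Fin k → ℕ) i → (∀ h → h ≢ i → f h ≡ g h) →
             sum f + g i ≡ sum g + f i
sum-update {suc _} f g i agree = begin
  sum f + g i                       ≡⟨ cong (_+ g i) (sum-remove f) ⟩
  f i + sum (f ∘ punchIn i) + g i   ≡⟨ cong (λ s → f i + s + g i) (sum-cong-≗ (λ h → agree _ (punchInᵢ≢i i h))) ⟩
  f i + sum (g ∘ punchIn i) + g i   ≡⟨ xy∙z≈zy∙x (f i) _ (g i) ⟩
  g i + sum (g ∘ punchIn i) + f i   ≡⟨ cong (_+ f i) (sum-remove g) ⟨
  sum g + f i                       ∎
  where open ≡-Reasoning

sum-update₂ : ∀ {k} (f g : Fin k → ℕ) {i j} → i ≢ j → (∀ h → h ≢ i → h ≢ j → f h ≡ g h) →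
              sum f + (g i + g j) ≡ sum g + (f i + f j)
sum-update₂ f g {i} {j} i≢j agree = begin
  sum f + (g i + g j)   ≡⟨ +-assoc (sum f) _ _ ⟨
  sum f + g i + g j     ≡⟨ cong (λ x → sum f + x + g j) mid-i ⟨
  sum f + mid i + g j   ≡⟨ cong (_+ g j) (sum-update f mid i f≗mid) ⟩
  sum mid + f i + g j   ≡⟨ xy∙z≈xz∙y (sum mid) (f i) (g j) ⟩
  sum mid + g j + f i   ≡⟨ cong (_+ f i) (sum-update mid g j mid≗g) ⟩
  sum g + mid j + f i   ≡⟨ cong (λ x → sum g + x + f i) (f≗mid j (i≢j ∘ sym)) ⟨
  sum g + f j + f i     ≡⟨ xy∙z≈xz∙y (sum g) (f j) (f i) ⟩
  sum g + f i + f j     ≡⟨ +-assoc (sum g) _ _ ⟩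
  sum g + (f i + f j)   ∎
  where
  open ≡-Reasoning
  mid : Fin _ → ℕ
  mid h with h ≟ i
  ... | yes _ = g h
  ... | no _  = f h
  mid-i : mid i ≡ g i
  mid-i with i ≟ i
  ... | yes _   = refl
  ... | no i≢i  = contradiction refl i≢i
  f≗mid : ∀ h → h ≢ i → f h ≡ mid h
  f≗mid h h≢i with h ≟ i
  ... | yes h≡i = contradiction h≡i h≢i
  ... | no _    = refl
  mid≗g : ∀ h → h ≢ j → mid h ≡ g h
  mid≗g h h≢j with h ≟ i
  ... | yes _   = refl
  ... | no h≢i  = agree h h≢i h≢j

rearrangement : ∀ {x y A B} → x <ℕ y → B <ℕ A → x * A + y * B <ℕ x * B + y * A
rearrangement {x} {A = A} {B} x<y B<A with m≤n⇒∃[o]m+o≡n x<y | m≤n⇒∃[o]m+o≡n B<A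
... | d , refl | e , refl = <-≤-trans (m<m+n _ z<s) (≤-reflexive (sym (gain x d B e)))
  where
  gain : ∀ x d B e → x * B + (suc x + d) * (suc B + e) ≡ x * (suc B + e) + (suc x + d) * B + suc d * suc e
  gain = solve 4 (λ x d B e → x :* B :+ (con 1 :+ x :+ d) :* (con 1 :+ B :+ e)
                           := x :* (con 1 :+ B :+ e) :+ (con 1 :+ x :+ d) :* B :+ (con 1 :+ d) :* (con 1 :+ e)) refl

sum-exchange-≡ : ∀ {k} (f g : Fin k → ℕ) {i j} → i ≢ j → (∀ h → h ≢ i → h ≢ j → f h ≡ g h) →
                 g i + g j ≡ f i + f j → sum g ≡ sum f
sum-exchange-≡ f g i≢j agree same =
  sym (+-cancelʳ-≡ _ (sum f) (sum g) (trans (cong (sum f +_) (sym same)) (sum-update₂ f g i≢j agree)))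

sum-exchange-< : ∀ {k} (f g : Fin k → ℕ) {i j} → i ≢ j → (∀ h → h ≢ i → h ≢ j → f h ≡ g h) →
                 f i + f j <ℕ g i + g j → sum f <ℕ sum g
sum-exchange-< f g i≢j agree gain =
  ≰⇒> λ g≤f → <-irrefl (sym (sum-update₂ f g i≢j agree)) (+-mono-≤-< g≤f gain)

==F⇒≡ : ∀ {k} {x y : Fin k} → T (x ==F y) → x ≡ y
==F⇒≡ = toℕ-injective ∘ ≡ᵇ⇒≡ _ _

==F-refl : ∀ {k} (x : Fin k) → T (x ==F x)
==F-refl x = ≡⇒≡ᵇ (toℕ x) (toℕ x) refl

module _ {n m : ℕ} where

  ==V⇒≡ : ∀ (u u' : V n m) → T (u ==V u') → u ≡ u'
  ==V⇒≡ (src x) (src y) t = cong src (==F⇒≡ t)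
  ==V⇒≡ (int x) (int y) t = cong int (==F⇒≡ t)
  ==V⇒≡ (snk x) (snk y) t = cong snk (==F⇒≡ t)
  ==V⇒≡ (src _) (int _) ()
  ==V⇒≡ (src _) (snk _) ()
  ==V⇒≡ (int _) (src _) ()
  ==V⇒≡ (int _) (snk _) ()
  ==V⇒≡ (snk _) (src _) ()
  ==V⇒≡ (snk _) (int _) ()

  ==V-refl : ∀ (u : V n m) → T (u ==V u)
  ==V-refl (src x) = ==F-refl x
  ==V-refl (int x) = ==F-refl x
  ==V-refl (snk x) = ==F-refl x

  ==V-reflects : ∀ (u u' : V n m) → Reflects (u ≡ u') (u ==V u')
  ==V-reflects u u' = fromEquivalence (==V⇒≡ u u') λ where refl → ==V-refl u

  ==S-reflects : ∀ (e f : Seg n m) → Reflects (e ≡ f) (e ==S f)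
  ==S-reflects (u , w) (u' , w') = fromEquivalence sound λ where refl → Equivalence.from T-∧ (==V-refl u , ==F-refl w)
    where
    sound : T ((u ==V u') ∧ (w ==F w')) → (u , w) ≡ (u' , w')
    sound t with Equivalence.to T-∧ t
    ... | tu , tw = cong₂ _,_ (==V⇒≡ u u' tu) (==F⇒≡ tw)

  memB-++ : ∀ (e : Seg n m) A C → memB e (A ++ C) ≡ memB e A ∨ memB e C
  memB-++ e []      C = refl
  memB-++ e (f ∷ A) C = trans (cong ((e ==S f) ∨_) (memB-++ e A C)) (sym (∨-assoc (e ==S f) _ _))

  memB⇒∈ : ∀ (e : Seg n m) A → T (memB e A) → e ∈ A
  memB⇒∈ e (f ∷ A) found with e ==S f | ==S-reflects e f
  ... | true  | ofʸ refl = here refl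
  ... | false | _        = there (memB⇒∈ e A found)

module StarNetwork {n m : ℕ} (a b : Fin m → ℕ) (B : Build m) where
  open Net {n} {m} a b B

  _∈[_] : ℕ → Fin m → Set
  x ∈[ K ] = a K ≤ suc x × suc x ≤ b K

  inI-reflects : ∀ K w → Reflects (toℕ w ∈[ K ]) (inI K w)
  inI-reflects K w = ≤ᵇ-reflects-≤ (a K) (suc (toℕ w)) ×-reflects ≤ᵇ-reflects-≤ (suc (toℕ w)) (b K)

  rank : V n m → ℕ
  rank (src _) = 0
  rank (int j) = suc (toℕ j)
  rank (snk _) = suc m

  tail : Seg n m → V n m
  tail = proj₁

  -- nxt s w is the first x_j with s ≤ j on wire w, or the sink; while
  -- scanning, the recursion inside nxt has only the indices c ≤ j left.
  Avoids : ℕ → ℕ → Fin n → ℕ → Set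
  Avoids c s w hi = ∀ K → c ≤ toℕ K → s ≤ toℕ K → toℕ K <ℕ hi → ¬ toℕ w ∈[ K ]

  data FirstStopFrom (c s : ℕ) (w : Fin n) : V n m → Set where
    stop : ∀ {j} → s ≤ toℕ j → toℕ w ∈[ j ] → Avoids c s w (toℕ j) → FirstStopFrom c s w (int j)
    exit : Avoids c s w m → FirstStopFrom c s w (snk w)

  -- The list recursion `go` local to `nxt` has no name of its own: the
  -- hole is filled by unification with `unfold`.
  nxt-go : ℕ → Fin n → List (Fin m) → V n m
  nxt-go s w = go
    where
    go : List (Fin m) → V n m
    go = _
    unfold : nxt s w ≡ go (allFin m)
    unfold with allFin m
    ... | Ks = refl

  widen : ∀ {c s w hi} → (∀ K → toℕ K ≡ c → s ≤ toℕ K → ¬ toℕ w ∈[ K ]) →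
          Avoids (suc c) s w hi → Avoids c s w hi
  widen first-fails avoids K c≤K s≤K K<hi with m≤n⇒m<n∨m≡n c≤K
  ... | inj₁ c<K = avoids K c<K s≤K K<hi
  ... | inj₂ c≡K = first-fails K (sym c≡K) s≤K

  relax : ∀ {c s w v} → (∀ K → toℕ K ≡ c → s ≤ toℕ K → ¬ toℕ w ∈[ K ]) →
          FirstStopFrom (suc c) s w v → FirstStopFrom c s w v
  relax first-fails (stop s≤j on avoids) = stop s≤j on (widen first-fails avoids)
  relax first-fails (exit avoids)        = exit (widen first-fails avoids)

  nxt-go-spec : ∀ s w {r} c (f : Fin r → Fin m) → (∀ x → toℕ (f x) ≡ c + toℕ x) → c + r ≡ m →
                FirstStopFrom c s w (nxt-go s w (tabulate f))
  nxt-go-spec s w {zero} c f _ c+0≡m =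
    exit λ K c≤K _ K<m _ → ≤⇒≯ c≤K (subst (toℕ K <ℕ_) (trans (sym c+0≡m) (+-identityʳ c)) K<m)
  nxt-go-spec s w {suc r} c f f-from c+r≡m
    with (s ≤ᵇ toℕ (f zero)) ∧ inI (f zero) w | ≤ᵇ-reflects-≤ s (toℕ (f zero)) ×-reflects inI-reflects (f zero) w
  ... | true  | ofʸ (s≤ , on) = stop s≤ on λ K c≤K _ K<f0 _ → ≤⇒≯ c≤K (subst (toℕ K <ℕ_) f0≡c K<f0)
    where f0≡c = trans (f-from zero) (+-identityʳ c)
  ... | false | ofⁿ fails = relax first-fails (nxt-go-spec s w (suc c) (f ∘ suc) f-from′ (trans (sym (+-suc c r)) c+r≡m))
    where
    f-from′ : ∀ x → toℕ (f (suc x)) ≡ suc c + toℕ x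
    f-from′ x = trans (f-from (suc x)) (+-suc c (toℕ x))
    first-fails : ∀ K → toℕ K ≡ c → s ≤ toℕ K → ¬ toℕ w ∈[ K ]
    first-fails K K≡c s≤K on with toℕ-injective (trans K≡c (sym (trans (f-from zero) (+-identityʳ c))))
    ... | refl = fails (s≤K , on)

  FirstStop : ℕ → Fin n → V n m → Set
  FirstStop = FirstStopFrom 0

  nxt-spec : ∀ s w → FirstStop s w (nxt s w)
  nxt-spec s w = nxt-go-spec s w 0 (λ x → x) (λ _ → refl) refl

  FirstStop-rank : ∀ {s w v} → s ≤ m → FirstStop s w v → s <ℕ rank v
  FirstStop-rank _   (stop s≤j _ _) = s≤s s≤j
  FirstStop-rank s≤m (exit _)       = s≤s s≤m

  FirstStop-avoids : ∀ {s w v} K → s ≤ toℕ K → suc (toℕ K) <ℕ rank v → FirstStop s w v → ¬ toℕ w ∈[ K ]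
  FirstStop-avoids K s≤K (s≤s K<j) (stop _ _ avoids) = avoids K z≤n s≤K K<j
  FirstStop-avoids K s≤K _         (exit avoids)     = avoids K z≤n s≤K (toℕ<n K)

  -- IsEdge does not determine its segment; wrapping it lets Agda infer the segment from a proof.
  record Edge (e : Seg n m) : Set where
    constructor edge
    field is-edge : IsEdge e

  edge-rank≤m : ∀ {u w} → Edge (u , w) → rank u ≤ m
  edge-rank≤m {src _} _ = z≤n
  edge-rank≤m {int j} _ = toℕ<n j
  edge-rank≤m {snk _} (edge ())

  head-spec : ∀ {u w} → Edge (u , w) → FirstStop (rank u) w (head (u , w))
  head-spec {src _} {w} _ = nxt-spec 0 w
  head-spec {int j} {w} _ = nxt-spec (suc (toℕ j)) w
  head-spec {snk _} (edge ())

  rank-<-head : ∀ {u w} → Edge (u , w) → rank u <ℕ rank (head (u , w))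
  rank-<-head e = FirstStop-rank (edge-rank≤m e) (head-spec e)

  head-avoids : ∀ {u w} → Edge (u , w) → ∀ K → rank u ≤ toℕ K → suc (toℕ K) <ℕ rank (head (u , w)) →
                ¬ toℕ w ∈[ K ]
  head-avoids e K u≤K K<head = FirstStop-avoids K u≤K K<head (head-spec e)

  head-on-wire : ∀ {u w j} → Edge (u , w) → head (u , w) ≡ int j → toℕ w ∈[ j ]
  head-on-wire {u} {w} e head≡j with head (u , w) | head-spec {u} {w} e
  head-on-wire {u} {w} e refl | int _ | stop _ on _ = on

  head-≢-src : ∀ {u w x} → Edge (u , w) → head (u , w) ≢ src x
  head-≢-src {u} {w} e head≡x with head (u , w) | head-spec {u} {w} e
  head-≢-src {u} {w} e refl | src _ | ()

  out-edge-on-wire : ∀ {j w} → Edge (int j , w) → toℕ w ∈[ j ]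
  out-edge-on-wire {j} {w} (edge e) with inI j w | inI-reflects j w
  ... | true  | ofʸ on = on
  ... | false | _      = contradiction e λ ()

  src-edge-wire : ∀ {x w} → Edge (src x , w) → x ≡ w
  src-edge-wire (edge e) = ==F⇒≡ (proj₁ (Equivalence.to T-∧ e))

  rank-≤-stop : ∀ {u w K} → Edge (u , w) → head (u , w) ≡ int K → rank u ≤ toℕ K
  rank-≤-stop ε head≡K = ≤-pred (subst (_ <ℕ_) (cong rank head≡K) (rank-<-head ε))

  -- Walks and the levels they cross

  data Walk : V n m → V n m → List (Seg n m) → Set where
    []  : ∀ {u} → Walk u u []
    _∷_ : ∀ {u w x es} → Edge (u , w) → Walk (head (u , w)) x es → Walk u x ((u , w) ∷ es)

  path⇒walk : ∀ {u t es} → PathFrom u t es → Walk u (snk t) es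
  path⇒walk done       = []
  path⇒walk (step e p) = edge e ∷ path⇒walk p

  walk⇒path : ∀ {u t es} → Walk u (snk t) es → PathFrom u t es
  walk⇒path []      = done
  walk⇒path (edge e ∷ p) = step e (walk⇒path p)

  walk-[] : ∀ {u x} → Walk u x [] → u ≡ x
  walk-[] [] = refl

  walk-++ : ∀ {u x y A C} → Walk u x A → Walk x y C → Walk u y (A ++ C)
  walk-++ []      q = q
  walk-++ (e ∷ p) q = e ∷ walk-++ p q

  walk-rank-≤ : ∀ {u x es} → Walk u x es → rank u ≤ rank x
  walk-rank-≤ []      = ≤-refl
  walk-rank-≤ (e ∷ p) = ≤-trans (<⇒≤ (rank-<-head e)) (walk-rank-≤ p)

  walk-edge : ∀ {u x es g} → Walk u x es → g ∈ es → Edge g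
  walk-edge (e ∷ _) (here refl) = e
  walk-edge (_ ∷ p) (there g∈)  = walk-edge p g∈

  walk-tail-rank : ∀ {u x es g} → Walk u x es → g ∈ es → rank u ≤ rank (tail g)
  walk-tail-rank (_ ∷ _) (here refl) = ≤-refl
  walk-tail-rank (e ∷ p) (there g∈)  = ≤-trans (<⇒≤ (rank-<-head e)) (walk-tail-rank p g∈)

  walk-head-rank : ∀ {u x es g} → Walk u x es → g ∈ es → rank u <ℕ rank (head g)
  walk-head-rank p g∈ = ≤-<-trans (walk-tail-rank p g∈) (rank-<-head (walk-edge p g∈))

  walk-head-rank-≤ : ∀ {u x es g} → Walk u x es → g ∈ es → rank (head g) ≤ rank x
  walk-head-rank-≤ (_ ∷ p) (here refl) = walk-rank-≤ p
  walk-head-rank-≤ (_ ∷ p) (there g∈)  = walk-head-rank-≤ p g∈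

  walk-head-injective : ∀ {u x es g g′} → Walk u x es → g ∈ es → g′ ∈ es → head g ≡ head g′ → g ≡ g′
  walk-head-injective (_ ∷ _) (here refl) (here refl) _  = refl
  walk-head-injective (_ ∷ p) (here refl) (there g′∈) eq = contradiction (cong rank eq) (<⇒≢ (walk-head-rank p g′∈))
  walk-head-injective (_ ∷ p) (there g∈)  (here refl) eq = contradiction (cong rank eq) (<⇒≢ (walk-head-rank p g∈) ∘ sym)
  walk-head-injective (_ ∷ p) (there g∈)  (there g′∈) eq = walk-head-injective p g∈ g′∈ eq

  -- Level t lies between the vertices of rank t and t + 1; wireAt es t is
  -- the wire of the edge of es crossing it.
  wireAt : List (Seg n m) → ℕ → ℕ
  wireAt []       t = 0
  wireAt (e ∷ es) t = if t <ᵇ rank (head e) then toℕ (wire e) else wireAt es t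

  -- 0 if es does not pass x_K, else one more than the wire along which it enters x_K
  entry : List (Seg n m) → Fin m → ℕ
  entry []       K = 0
  entry (e ∷ es) K = if head e ==V int K then suc (toℕ (wire e)) else entry es K

  Visits : List (Seg n m) → Fin m → Set
  Visits es K = 0 <ℕ entry es K

  wireAt-here : ∀ e es {t} → t <ℕ rank (head e) → wireAt (e ∷ es) t ≡ toℕ (wire e)
  wireAt-here _ _ = if-yes (<ᵇ-reflects-< _ _)

  wireAt-skip : ∀ e es {t} → rank (head e) ≤ t → wireAt (e ∷ es) t ≡ wireAt es t
  wireAt-skip _ _ = if-no (<ᵇ-reflects-< _ _) ∘ ≤⇒≯

  entry-here : ∀ e es {K} → head e ≡ int K → entry (e ∷ es) K ≡ suc (toℕ (wire e))
  entry-here e _ = if-yes (==V-reflects (head e) _)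

  entry-skip : ∀ e es {K} → head e ≢ int K → entry (e ∷ es) K ≡ entry es K
  entry-skip e _ = if-no (==V-reflects (head e) _)

  entry≤n : ∀ es K → entry es K ≤ n
  entry≤n []       K = z≤n
  entry≤n (e ∷ es) K with head e ==V int K
  ... | true  = toℕ<n (wire e)
  ... | false = entry≤n es K

  wireAt-edge : ∀ {u x es g t} → Walk u x es → g ∈ es → rank (tail g) ≤ t → t <ℕ rank (head g) →
                wireAt es t ≡ toℕ (wire g)
  wireAt-edge {es = g ∷ es} (_ ∷ _) (here refl) _   t<g = wireAt-here g es t<g
  wireAt-edge {es = e ∷ es} (_ ∷ p) (there g∈)  g≤t t<g =
    trans (wireAt-skip e es (≤-trans (walk-tail-rank p g∈) g≤t)) (wireAt-edge p g∈ g≤t t<g)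

  wireAt-leaving : ∀ {u x es g} → Walk u x es → g ∈ es → wireAt es (rank (tail g)) ≡ toℕ (wire g)
  wireAt-leaving P g∈ = wireAt-edge P g∈ ≤-refl (rank-<-head (walk-edge P g∈))

  wireAt-before-stop : ∀ {u x es g K} → Walk u x es → g ∈ es → head g ≡ int K → wireAt es (toℕ K) ≡ toℕ (wire g)
  wireAt-before-stop {g = g} P g∈ g→K =
    wireAt-edge P g∈ (≤-pred (subst (rank (tail g) <ℕ_) (cong rank g→K) (rank-<-head (walk-edge P g∈))))
                     (subst (_ <ℕ_) (sym (cong rank g→K)) (n<1+n _))

  wireAt-start : ∀ {i t es} → Walk (src i) (snk t) es → wireAt es 0 ≡ toℕ i
  wireAt-start {es = e ∷ es} (ε ∷ _) = trans (wireAt-here e es (rank-<-head ε)) (cong toℕ (sym (src-edge-wire ε)))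

  entry-edge : ∀ {u x es g K} → Walk u x es → g ∈ es → head g ≡ int K → entry es K ≡ suc (toℕ (wire g))
  entry-edge {es = g ∷ es} (_ ∷ _) (here refl) g→K = entry-here g es g→K
  entry-edge {es = e ∷ es} (_ ∷ p) (there g∈)  g→K =
    trans (entry-skip e es λ e→K → <⇒≢ (walk-head-rank p g∈) (cong rank (trans e→K (sym g→K))))
          (entry-edge p g∈ g→K)

  entry-behind : ∀ {u x es K} → Walk u x es → rank (int K) ≤ rank u → entry es K ≡ 0
  entry-behind                  []      _   = refl
  entry-behind {es = e ∷ es} (ε ∷ p) K≤u =
    trans (entry-skip e es λ e→K → <⇒≱ (rank-<-head ε) (subst (_≤ _) (cong rank (sym e→K)) K≤u))
          (entry-behind p (≤-trans K≤u (<⇒≤ (rank-<-head ε))))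

  entry-visit : ∀ es K → Visits es K → ∃ λ g → g ∈ es × head g ≡ int K
  entry-visit (e ∷ es) K pos with head e ==V int K | ==V-reflects (head e) (int K)
  ... | true  | ofʸ e→K = e , here refl , e→K
  ... | false | ofⁿ _ with entry-visit es K pos
  ...   | g , g∈ , g→K = g , there g∈ , g→K

  Below : List (Seg n m) → List (Seg n m) → ℕ → Set
  Below p q t = wireAt p t <ℕ wireAt q t

  rank≡int : ∀ {K} (v : V n m) → rank v ≡ suc (toℕ K) → v ≡ int K
  rank≡int     (src _) ()
  rank≡int     (int j) eq = cong int (toℕ-injective (suc-injective eq))
  rank≡int {K} (snk _) eq = contradiction (sym (suc-injective eq)) (<⇒≢ (toℕ<n K))

  -- A walk with entry value e at x_K, on wires w₀ and w₁ at levels toℕ K and suc (toℕ K).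
  data Crossing (K : Fin m) (e w₀ w₁ : ℕ) : Set where
    passes : 0 <ℕ e → w₀ ∈[ K ] → w₁ ∈[ K ] → Crossing K e w₀ w₁
    misses : e ≡ 0 → w₁ ≡ w₀ → ¬ w₀ ∈[ K ] → Crossing K e w₀ w₁

  Crossing-cong : ∀ {K e e′ w₀ w₀′ w₁ w₁′} → e ≡ e′ → w₀ ≡ w₀′ → w₁ ≡ w₁′ →
                  Crossing K e w₀ w₁ → Crossing K e′ w₀′ w₁′
  Crossing-cong refl refl refl c = c

  -- A walk through x_K stays inside the interval of wires of x_K, a walk missing x_K stays outside it.
  crossing-order : ∀ {K e w₀ w₁ e′ w₀′ w₁′} → Crossing K e w₀ w₁ → Crossing K e′ w₀′ w₁′ →
                   ¬ (0 <ℕ e × 0 <ℕ e′) → w₀ <ℕ w₀′ → w₁ <ℕ w₁′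
  crossing-order (passes e>0 _ _) (passes e′>0 _ _) not-both _ = contradiction (e>0 , e′>0) not-both
  crossing-order (misses _ refl _) (misses _ refl _) _ w₀<w₀′ = w₀<w₀′
  crossing-order (passes _ (a≤w₀ , _) (_ , w₁≤b)) (misses _ refl off) _ w₀<w₀′ =
    ≤-pred (≤-<-trans w₁≤b (≰⇒> λ w₀′≤b → off (≤-trans a≤w₀ (<⇒≤ (s≤s w₀<w₀′)) , w₀′≤b)))
  crossing-order (misses _ refl off) (passes _ (_ , w₀′≤b) (a≤w₁′ , _)) _ w₀<w₀′ =
    ≤-pred (<-≤-trans (≰⇒> λ a≤w₀ → off (a≤w₀ , ≤-trans (s≤s (<⇒≤ w₀<w₀′)) w₀′≤b)) a≤w₁′)

  leaving-wire : ∀ {K t es} → Walk (int K) (snk t) es → wireAt es (suc (toℕ K)) ∈[ K ]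
  leaving-wire {K} {es = e ∷ es} (ε ∷ _) = subst (_∈[ K ]) (sym (wireAt-here e es (rank-<-head ε))) (out-edge-on-wire ε)

  entry-jumped : ∀ {u w x es K} → Walk u x ((u , w) ∷ es) → suc (toℕ K) <ℕ rank (head (u , w)) →
                 entry ((u , w) ∷ es) K ≡ 0
  entry-jumped {u} {w} {es = es} (_ ∷ p) K<head =
    trans (entry-skip (u , w) es (<⇒≢ K<head ∘ sym ∘ cong rank)) (entry-behind p (<⇒≤ K<head))

  level-crossing : ∀ {u t es} K → Walk u (snk t) es → rank u ≤ toℕ K →
                   Crossing K (entry es K) (wireAt es (toℕ K)) (wireAt es (suc (toℕ K)))
  level-crossing K [] m<K = ⊥-elim (<-asym (toℕ<n K) m<K)
  level-crossing K (_∷_ {u} {w} {es = es} ε p) u≤K with <-cmp (suc (toℕ K)) (rank (head (u , w)))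
  ... | tri< K<head _ _ =
    misses (entry-jumped (ε ∷ p) K<head)
           (trans (wireAt-here (u , w) es K<head) (sym on-w))
           (head-avoids ε K u≤K K<head ∘ subst (_∈[ K ]) on-w)
    where on-w = wireAt-here (u , w) es (<-trans (n<1+n _) K<head)
  ... | tri≈ _ K≡head _ =
    passes (subst (0 <ℕ_) (sym (entry-here (u , w) es head≡K)) z<s)
           (subst (_∈[ K ]) (sym (wireAt-here (u , w) es (≤-reflexive K≡head))) (head-on-wire ε head≡K))
           (subst (_∈[ K ]) (sym (wireAt-skip (u , w) es (≤-reflexive (sym K≡head))))
                  (leaving-wire (subst (λ v → Walk v _ es) head≡K p)))
    where head≡K = rank≡int (head (u , w)) (sym K≡head)
  ... | tri> _ _ head≤K =
    Crossing-cong (sym (entry-skip (u , w) es (<⇒≢ head≤K ∘ cong rank)))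
                  (sym (wireAt-skip (u , w) es (≤-pred head≤K)))
                  (sym (wireAt-skip (u , w) es (<⇒≤ head≤K)))
                  (level-crossing K p (≤-pred head≤K))

  Meet : List (Seg n m) → List (Seg n m) → Fin m → Set
  Meet p q K = Visits p K × Visits q K

  order-step : ∀ {u u′ t t′ p q} K → Walk u (snk t) p → Walk u′ (snk t′) q → rank u ≤ toℕ K → rank u′ ≤ toℕ K →
               ¬ Meet p q K → Below p q (toℕ K) → Below p q (suc (toℕ K))
  order-step K P Q u≤K u′≤K = crossing-order (level-crossing K P u≤K) (level-crossing K Q u′≤K)

  order-preserved : ∀ {u u′ t t′ p q t₀} t₁ → Walk u (snk t) p → Walk u′ (snk t′) q →
                    rank u ≤ t₀ → rank u′ ≤ t₀ → t₀ ≤ t₁ → t₁ ≤ m →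
                    (∀ K → t₀ ≤ toℕ K → toℕ K <ℕ t₁ → ¬ Meet p q K) →
                    Below p q t₀ → Below p q t₁
  order-preserved t₁ P Q u≤t₀ u′≤t₀ t₀≤t₁ t₁≤m apart below with m≤n⇒m<n∨m≡n t₀≤t₁
  ... | inj₂ refl = below
  order-preserved {p = p} {q} (suc t₁) P Q u≤t₀ u′≤t₀ _ t₁<m apart below | inj₁ (s≤s t₀≤t₁) =
    subst (λ t → Below p q (suc t)) K≡t₁
      (order-step K P Q (≤-trans u≤t₀ t₀≤K) (≤-trans u′≤t₀ t₀≤K) (apart K t₀≤K (s≤s (≤-reflexive K≡t₁)))
                  (subst (Below p q) (sym K≡t₁) below-t₁))
    where
    K = fromℕ< t₁<m
    K≡t₁ = toℕ-fromℕ< t₁<m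
    t₀≤K = subst (_ ≤_) (sym K≡t₁) t₀≤t₁
    below-t₁ = order-preserved t₁ P Q u≤t₀ u′≤t₀ t₀≤t₁ (<⇒≤ t₁<m)
                               (λ K t₀≤K K<t₁ → apart K t₀≤K (<-trans K<t₁ (n<1+n _))) below

  order-until-stop : ∀ {u w t S K u′ t′ q} → Walk u (snk t) ((u , w) ∷ S) → Walk u′ (snk t′) q →
                     rank u′ ≤ rank u → head (u , w) ≡ int K →
                     (wireAt q (rank u) <ℕ toℕ w → wireAt q (toℕ K) <ℕ toℕ w)
                   × (toℕ w <ℕ wireAt q (rank u) → toℕ w <ℕ wireAt q (toℕ K))
  order-until-stop {u} {w} {S = S} {K} P@(ε ∷ _) Q u′≤u head≡K =
      (λ q<w → subst (_ <ℕ_) on-w-K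
                 (order-preserved (toℕ K) Q P u′≤u ≤-refl u≤K K≤m (λ K′ u≤K′ K′<K → no-visit K′ u≤K′ K′<K ∘ proj₂)
                                  (subst (_ <ℕ_) (sym on-w-u) q<w)))
    , (λ w<q → subst (_<ℕ _) on-w-K
                 (order-preserved (toℕ K) P Q ≤-refl u′≤u u≤K K≤m (λ K′ u≤K′ K′<K → no-visit K′ u≤K′ K′<K ∘ proj₁)
                                  (subst (_<ℕ _) (sym on-w-u) w<q)))
    where
    u≤K : rank u ≤ toℕ K
    u≤K = rank-≤-stop ε head≡K
    K≤m : toℕ K ≤ m
    K≤m = <⇒≤ (toℕ<n K)
    on-w-u : wireAt ((u , w) ∷ S) (rank u) ≡ toℕ w
    on-w-u = wireAt-here (u , w) S (rank-<-head ε)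
    on-w-K : wireAt ((u , w) ∷ S) (toℕ K) ≡ toℕ w
    on-w-K = wireAt-before-stop P (here refl) head≡K
    no-visit : ∀ K′ → rank u ≤ toℕ K′ → toℕ K′ <ℕ toℕ K → ¬ Visits ((u , w) ∷ S) K′
    no-visit K′ _ K′<K visits =
      <⇒≢ visits (sym (entry-jumped P (<-≤-trans (s≤s K′<K) (≤-reflexive (sym (cong rank head≡K))))))

  order-past-stop : ∀ {u w w₂ t S K u′ t′ q} → Walk u (snk t) ((u , w) ∷ (head (u , w) , w₂) ∷ S) →
                    Walk u′ (snk t′) q → rank u′ ≤ rank u → head (u , w) ≡ int K → ¬ Visits q K →
                    (wireAt q (rank u) <ℕ toℕ w → wireAt q (rank (head (u , w))) <ℕ toℕ w₂)
                  × (toℕ w <ℕ wireAt q (rank u) → toℕ w₂ <ℕ wireAt q (rank (head (u , w))))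
  order-past-stop {u} {w} {w₂} {S = S} {K} {q = q} P@(ε ∷ _) Q u′≤u head≡K q-misses =
      (λ q<w → subst₂ _<ℕ_ q-after p-after
                 (order-step K Q P (≤-trans u′≤u u≤K) u≤K (q-misses ∘ proj₁)
                             (subst (_ <ℕ_) (sym p-before) (proj₁ (order-until-stop P Q u′≤u head≡K) q<w))))
    , (λ w<q → subst₂ _<ℕ_ p-after q-after
                 (order-step K P Q u≤K (≤-trans u′≤u u≤K) (q-misses ∘ proj₂)
                             (subst (_<ℕ _) (sym p-before) (proj₂ (order-until-stop P Q u′≤u head≡K) w<q))))
    where
    p = (u , w) ∷ (head (u , w) , w₂) ∷ S
    rank-head : suc (toℕ K) ≡ rank (head (u , w))
    rank-head = cong rank (sym head≡K)
    u≤K : rank u ≤ toℕ K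
    u≤K = rank-≤-stop ε head≡K
    p-before : wireAt p (toℕ K) ≡ toℕ w
    p-before = wireAt-before-stop P (here refl) head≡K
    p-after : wireAt p (suc (toℕ K)) ≡ toℕ w₂
    p-after = trans (cong (wireAt p) rank-head) (wireAt-leaving P (there (here refl)))
    q-after : wireAt q (suc (toℕ K)) ≡ wireAt q (rank (head (u , w)))
    q-after = cong (wireAt q) rank-head

  findV-just : ∀ {u x es v iq oq} → Walk u x es → findV v (visits es) ≡ just (iq , oq) →
               iq ∈ es × oq ∈ es × head iq ≡ v × tail oq ≡ v
  findV-just {es = e ∷ f ∷ es} {v} (_ ∷ P) found with tail f ==V v | ==V-reflects (tail f) v
  findV-just (_ ∷ _ ∷ _) refl | true  | ofʸ f≡v = here refl , there (here refl) , f≡v , f≡v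
  findV-just (_ ∷ P)     found | false | ofⁿ _ with findV-just P found
  ... | iq∈ , oq∈ , iq→v , oq←v = there iq∈ , there oq∈ , iq→v , oq←v

  findV-found : ∀ {u t es g K} → Walk u (snk t) es → g ∈ es → head g ≡ int K →
                ∃ λ oq → findV (int K) (visits es) ≡ just (g , oq)
  findV-found {es = g ∷ f ∷ _} {K = K} (_ ∷ _ ∷ _) (here refl) g→K = f , if-yes (==V-reflects (tail f) (int K)) g→K
  findV-found {es = g ∷ []} (_ ∷ p) (here refl) g→K = contradiction (trans (sym (walk-[] p)) g→K) λ ()
  findV-found {es = e ∷ f ∷ _} {K = K} (_ ∷ P@(_ ∷ _)) (there g∈) g→K =
    let oq , found = findV-found P g∈ g→K
    in oq , trans (if-no (==V-reflects (tail f) (int K))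
                         λ f→K → <⇒≢ (walk-head-rank P g∈) (cong rank (trans f→K (sym g→K))))
                  found

  findV-nothing : ∀ {u t es K} → Walk u (snk t) es → findV (int K) (visits es) ≡ nothing → ¬ Visits es K
  findV-nothing {es = es} {K} P missing visits with entry-visit es K visits
  ... | g , g∈ , g→K with findV-found P g∈ g→K
  ...   | _ , found = contradiction (trans (sym missing) found) λ ()

  int-injective : ∀ {K K′} → int {n} {m} K ≡ int K′ → K ≡ K′
  int-injective refl = refl

  interior : ∀ {v w} → Edge (v , w) → (∀ {x} → v ≢ src x) → ∃ λ K → v ≡ int K
  interior {src _} _         not-src = contradiction refl not-src
  interior {int K} _         _       = K , refl
  interior {snk _} (edge ()) _

  -- Defects as inversions

  record Inverted (p q : List (Seg n m)) (k : Fin m) : Set where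
    constructor inverted
    field
      visited : Visits q k
      q-below : entry q k <ℕ entry p k

  Inverted-cong : ∀ {p p′ q q′ k} → entry p k ≡ entry p′ k → entry q k ≡ entry q′ k →
                  Inverted p q k ⇔ Inverted p′ q′ k
  Inverted-cong p≡p′ q≡q′ =
    mk⇔ (λ (inverted v lt) → inverted (subst (0 <ℕ_) q≡q′ v) (subst₂ _<ℕ_ q≡q′ p≡p′ lt))
        (λ (inverted v lt) → inverted (subst (0 <ℕ_) (sym q≡q′) v) (subst₂ _<ℕ_ (sym q≡q′) (sym p≡p′) lt))

  Inverted? : ∀ p q k → Dec (Inverted p q k)
  Inverted? p q k = map′ (λ (visited , below) → inverted visited below) (λ (inverted visited below) → visited , below)
                         (0 <? entry q k ×-dec entry q k <? entry p k)

  not-xor-cancel : ∀ x c → not x xor (x xor c) ≡ not c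
  not-xor-cancel true  c = refl
  not-xor-cancel false c = refl

  module Characterisation {j tq q} (Q : Walk (src j) (snk tq) q) (k : Fin m) where

    Scan : Bool → Bool → List (Seg n m) → Set
    Scan par ent p = T (scan par ent (shared (visits p) (visits q)) k)

    -- How the scan state (par , ent) reflects the position of p's current
    -- edge e relative to q: par says whether p runs above q, and while the
    -- paths share edges, ent says whether p came in from below.
    data Tracks (e : Seg n m) : Bool → Bool → Set where
      together : ∀ {ent} → e ∈ q → Tracks e (not ent) ent
      above    : ∀ {ent} → wireAt q (rank (tail e)) <ℕ toℕ (wire e) → Tracks e true ent
      below    : ∀ {ent} → toℕ (wire e) <ℕ wireAt q (rank (tail e)) → Tracks e false ent

    data Arrival (e iq : Seg n m) : Bool → Bool → Set where
      same-edge  : ∀ {ent} → iq ≡ e → Arrival e iq (not ent) ent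
      from-above : ∀ {ent} → toℕ (wire iq) <ℕ toℕ (wire e) → Arrival e iq true ent
      from-below : ∀ {ent} → toℕ (wire e) <ℕ toℕ (wire iq) → Arrival e iq false ent

    entered : Seg n m → Seg n m → Bool → Bool
    entered e iq ent = if not (e ==S iq) then toℕ (wire e) <ᵇ toℕ (wire iq) else ent

    arrival : ∀ {u w t S iq par ent K} → Walk u (snk t) ((u , w) ∷ S) → head (u , w) ≡ int K →
              iq ∈ q → head iq ≡ int K → Tracks (u , w) par ent → Arrival (u , w) iq par ent
    arrival P head≡K iq∈ iq→K (together e∈) = same-edge (walk-head-injective Q iq∈ e∈ (trans iq→K (sym head≡K)))
    arrival P head≡K iq∈ iq→K (above q<w)   =
      from-above (subst (_<ℕ _) (wireAt-before-stop Q iq∈ iq→K) (proj₁ (order-until-stop P Q z≤n head≡K) q<w))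
    arrival P head≡K iq∈ iq→K (below w<q)   =
      from-below (subst (_ <ℕ_) (wireAt-before-stop Q iq∈ iq→K) (proj₂ (order-until-stop P Q z≤n head≡K) w<q))

    arrival-parity : ∀ {e iq par ent} → Arrival e iq par ent → par ≡ not (entered e iq ent)
    arrival-parity {e} {iq} arr with e ==S iq | ==S-reflects e iq
    arrival-parity (same-edge _)     | true  | _         = refl
    arrival-parity (same-edge iq≡e)  | false | ofⁿ e≢iq  = contradiction (sym iq≡e) e≢iq
    arrival-parity (from-above iq<e) | true  | ofʸ refl  = contradiction iq<e (<-irrefl refl)
    arrival-parity (from-above iq<e) | false | _         = cong not (sym (det (<ᵇ-reflects-< _ _) (ofⁿ (<⇒≯ iq<e))))
    arrival-parity (from-below e<iq) | true  | ofʸ refl  = contradiction e<iq (<-irrefl refl)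
    arrival-parity (from-below e<iq) | false | _         = cong not (sym (det (<ᵇ-reflects-< _ _) (ofʸ e<iq)))

    arrival-meets-here : ∀ {e iq par ent} (v : V n m) → Arrival e iq par ent →
                         T (not (e ==S iq) ∧ (v ==V int k) ∧ par) ⇔ (v ≡ int k × toℕ (wire iq) <ℕ toℕ (wire e))
    arrival-meets-here {e} {iq} {par} v arr =
      ⇔-trans (T⇔ (¬-reflects (==S-reflects e iq) ×-reflects ==V-reflects v (int k) ×-reflects T-reflects par))
              (logic arr)
      where
      logic : ∀ {par ent} → Arrival e iq par ent →
              (e ≢ iq × v ≡ int k × T par) ⇔ (v ≡ int k × toℕ (wire iq) <ℕ toℕ (wire e))
      logic (same-edge refl)  = mk⇔ (λ (e≢e , _) → contradiction refl e≢e) λ (_ , e<e) → contradiction e<e (<-irrefl refl)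
      logic (from-above iq<e) = mk⇔ (λ (_ , v≡k , _) → v≡k , iq<e)
                                    (λ (v≡k , _) → (λ e≡iq → <-irrefl (cong (toℕ ∘ wire) (sym e≡iq)) iq<e) , v≡k , _)
      logic (from-below e<iq) = mk⇔ (λ ()) λ (_ , iq<e) → contradiction iq<e (<-asym e<iq)

    departure : ∀ {x w₂ ow par ent} → (x , ow) ∈ q → par ≡ not ent →
                Tracks (x , w₂) (if not ((x , w₂) ==S (x , ow))
                                 then par xor (ent xor (toℕ w₂ <ᵇ toℕ ow)) else par) ent
    departure {x} {w₂} {ow} {ent = ent} oq∈ refl with (x , w₂) ==S (x , ow) | ==S-reflects (x , w₂) (x , ow)
    ... | true  | ofʸ refl = together oq∈
    ... | false | ofⁿ differ rewrite not-xor-cancel ent (toℕ w₂ <ᵇ toℕ ow)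
      with toℕ w₂ <ᵇ toℕ ow | <ᵇ-reflects-< (toℕ w₂) (toℕ ow)
    ...   | true  | ofʸ w₂<ow  = below (subst (toℕ w₂ <ℕ_) (sym (wireAt-leaving Q oq∈)) w₂<ow)
    ...   | false | ofⁿ w₂≮ow  =
      above (subst (_<ℕ toℕ w₂) (sym (wireAt-leaving Q oq∈))
                   (≤∧≢⇒< (≮⇒≥ w₂≮ow) (differ ∘ cong (x ,_) ∘ sym ∘ toℕ-injective)))

    bypass : ∀ {u w w₂ t S par ent K} → Walk u (snk t) ((u , w) ∷ (head (u , w) , w₂) ∷ S) →
             head (u , w) ≡ int K → ¬ Visits q K → Tracks (u , w) par ent → Tracks (head (u , w) , w₂) par ent
    bypass P head≡K q-misses (together e∈) = contradiction (subst (0 <ℕ_) (sym (entry-edge Q e∈ head≡K)) z<s) q-misses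
    bypass P head≡K q-misses (above q<w) = above (proj₁ (order-past-stop P Q z≤n head≡K q-misses) q<w)
    bypass P head≡K q-misses (below w<q) = below (proj₂ (order-past-stop P Q z≤n head≡K q-misses) w<q)

    inverted-bypass : ∀ {e rest K} → head e ≡ int K → ¬ Visits q K → Inverted (e ∷ rest) q k ⇔ Inverted rest q k
    inverted-bypass {e} {rest} {K} head≡K q-misses with K ≟ k
    ... | yes refl = mk⇔ (λ (inverted q-visits _) → contradiction q-visits q-misses)
                         (λ (inverted q-visits _) → contradiction q-visits q-misses)
    ... | no K≢k   = Inverted-cong (entry-skip e rest (K≢k ∘ int-injective ∘ trans (sym head≡K))) refl

    inverted-meet : ∀ {u w t rest K iq} → Walk u (snk t) ((u , w) ∷ rest) → head (u , w) ≡ int K →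
                    iq ∈ q → head iq ≡ int K →
                    ((head (u , w) ≡ int k × toℕ (wire iq) <ℕ toℕ w) ⊎ Inverted rest q k)
                    ⇔ Inverted ((u , w) ∷ rest) q k
    inverted-meet {u} {w} {rest = rest} {K} {iq} (_ ∷ P) head≡K iq∈ iq→K with K ≟ k
    ... | yes refl = mk⇔ to from
      where
      q-entry : entry q k ≡ suc (toℕ (wire iq))
      q-entry = entry-edge Q iq∈ iq→K
      p-entry : entry ((u , w) ∷ rest) k ≡ suc (toℕ w)
      p-entry = entry-here (u , w) rest head≡K
      to : _ → Inverted ((u , w) ∷ rest) q k
      to (inj₁ (_ , iq<w))   = inverted (subst (0 <ℕ_) (sym q-entry) z<s) (subst₂ _<ℕ_ (sym q-entry) (sym p-entry) (s≤s iq<w))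
      to (inj₂ (inverted _ q<rest)) =
        contradiction (subst (_ <ℕ_) (entry-behind P (≤-reflexive (cong rank (sym head≡K)))) q<rest) n≮0
      from : Inverted ((u , w) ∷ rest) q k → _
      from (inverted _ q<p) = inj₁ (head≡K , ≤-pred (subst₂ _<ℕ_ q-entry p-entry q<p))
    ... | no K≢k = mk⇔ to (inj₂ ∘ Equivalence.to same)
      where
      same : Inverted ((u , w) ∷ rest) q k ⇔ Inverted rest q k
      same = Inverted-cong (entry-skip (u , w) rest (K≢k ∘ int-injective ∘ trans (sym head≡K))) refl
      to : _ → Inverted ((u , w) ∷ rest) q k
      to (inj₁ (head≡k , _)) = contradiction (int-injective (trans (sym head≡K) head≡k)) K≢k
      to (inj₂ rest-inverted) = Equivalence.from same rest-inverted

    scan-correct : ∀ {u w t S} par ent → Walk u (snk t) ((u , w) ∷ S) → Tracks (u , w) par ent →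
                   Scan par ent ((u , w) ∷ S) ⇔ Inverted ((u , w) ∷ S) q k
    scan-correct {u} {w} {S = []} par ent (_ ∷ p) _ =
      mk⇔ (λ ()) λ (inverted _ q<p) → n≮0 (subst (_ <ℕ_) p-misses q<p)
      where
      p-misses : entry ((u , w) ∷ []) k ≡ 0
      p-misses = entry-skip (u , w) [] λ head≡k → contradiction (trans (sym (walk-[] p)) head≡k) λ ()
    scan-correct {u} {w} {S = (_ , w₂) ∷ S} par ent P@(ε ∷ p@(ε₂ ∷ _)) tracks
      with interior ε₂ (head-≢-src ε) | findV (head (u , w)) (visits q) in found
    ... | K , head≡K | nothing =
      ⇔-trans (scan-correct par ent p (bypass P head≡K q-misses tracks)) (⇔-sym (inverted-bypass head≡K q-misses))
      where
      q-misses : ¬ Visits q K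
      q-misses = findV-nothing Q (trans (cong (λ v → findV v (visits q)) (sym head≡K)) found)
    ... | K , head≡K | just (iq , (ou , ow)) with findV-just Q found
    ...   | iq∈ , oq∈ , iq→x , refl =
      ⇔-trans T-∨ (⇔-trans (arrival-meets-here _ arr ⊎-⇔ scan-correct _ _ p (departure oq∈ (arrival-parity arr)))
                           (inverted-meet P head≡K iq∈ (trans iq→x head≡K)))
      where
      arr = arrival P head≡K iq∈ (trans iq→x head≡K) tracks

  defect⇔inverted : ∀ {i j ti tj p q} k → PathFrom (src i) ti p → PathFrom (src j) tj q → toℕ i <ℕ toℕ j →
                    T (scan false false (shared (visits p) (visits q)) k) ⇔ Inverted p q k
  defect⇔inverted k P Q i<j with path⇒walk P
  ... | P′@(ε ∷ _) = scan-correct false false P′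
                       (below (subst₂ _<ℕ_ (cong toℕ (src-edge-wire ε)) (sym (wireAt-start (path⇒walk Q))) i<j))
    where open Characterisation (path⇒walk Q) k

  entry-wire : ∀ {u x es K} → Walk u x es → Visits es K → entry es K ≡ suc (wireAt es (toℕ K))
  entry-wire {es = es} {K} P visits with entry-visit es K visits
  ... | g , g∈ , g→K = trans (entry-edge P g∈ g→K) (cong suc (sym (wireAt-before-stop P g∈ g→K)))

  inverted⇒earlier-meeting : ∀ {i j ti tj p q} k → PathFrom (src i) ti p → PathFrom (src j) tj q → toℕ i <ℕ toℕ j →
                             Inverted p q k → ∃ λ l → toℕ l <ℕ toℕ k × Meet p q l
  inverted⇒earlier-meeting {p = p} {q} k P Q i<j (inverted q-visits q<p)
    with any? (λ l → toℕ l <? toℕ k ×-dec 0 <? entry p l ×-dec 0 <? entry q l)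
  ... | yes meeting = meeting
  ... | no none = contradiction p-below-q (<⇒≯ (≤-pred (subst₂ _<ℕ_ (entry-wire Q′ q-visits) (entry-wire P′ p-visits) q<p)))
    where
    P′ = path⇒walk P
    Q′ = path⇒walk Q
    p-visits : Visits p k
    p-visits = <-trans q-visits q<p
    p-below-q : Below p q (toℕ k)
    p-below-q = order-preserved (toℕ k) P′ Q′ z≤n z≤n z≤n (<⇒≤ (toℕ<n k)) (λ l _ l<k meet → none (l , l<k , meet))
                                (subst₂ _<ℕ_ (sym (wireAt-start P′)) (sym (wireAt-start Q′)) i<j)

  entry-++-behind : ∀ {u x A C K} → Walk u x A → rank x <ℕ rank (int K) → entry (A ++ C) K ≡ entry C K
  entry-++-behind []                      _   = refl
  entry-++-behind {A = e ∷ A} {C} (_ ∷ p) x<K =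
    trans (entry-skip e (A ++ C) λ e→K → <⇒≱ x<K (subst (_≤ _) (cong rank e→K) (walk-rank-≤ p)))
          (entry-++-behind p x<K)

  entry-++-stop : ∀ {u A C K} → Walk u (int K) A → rank u <ℕ rank (int K) → entry (A ++ C) K ≡ entry A K
  entry-++-stop [] K<K = contradiction K<K (<-irrefl refl)
  entry-++-stop {A = e ∷ A} {C} {K} (_ ∷ p) _ with head e ==V int K | ==V-reflects (head e) (int K)
  ... | true  | _       = refl
  ... | false | ofⁿ e↛K = entry-++-stop p (≤∧≢⇒< (walk-rank-≤ p) (e↛K ∘ rank≡int (head e)))

  split-at : ∀ {u y es} K → Walk u y es → Visits es K →
             ∃₂ λ A C → es ≡ A ++ C × Walk u (int K) A × Walk (int K) y C
  split-at K (_∷_ {u} {w} {es = es} ε p) visits with head (u , w) ==V int K | ==V-reflects (head (u , w)) (int K)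
  ... | true  | ofʸ head≡K = (u , w) ∷ [] , es , refl , ε ∷ subst (λ v → Walk v (int K) []) (sym head≡K) []
                                                    , subst (λ v → Walk v _ es) head≡K p
  ... | false | ofⁿ _ with split-at K p visits
  ...   | A , C , refl , pA , pC = (u , w) ∷ A , C , refl , ε ∷ pA , pC

  walks-disjoint : ∀ {u x y A C} e → Walk u x A → Walk x y C → ¬ (T (memB e A) × T (memB e C))
  walks-disjoint {A = A} {C} e P R (in-A , in-C) =
    <-irrefl refl (<-≤-trans (rank-<-head (walk-edge R e∈C)) (≤-trans (walk-head-rank-≤ P e∈A) (walk-tail-rank R e∈C)))
    where
    e∈A = memB⇒∈ e A in-A
    e∈C = memB⇒∈ e C in-C

  count-++ : ∀ {u x y A C} e → Walk u x A → Walk x y C →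
             fromBool (memB e (A ++ C)) ≡ fromBool (memB e A) + fromBool (memB e C)
  count-++ {A = A} {C} e P R = trans (cong fromBool (memB-++ e A C)) (fromBool-∨ _ _ (walks-disjoint e P R))

  -- Exchanging two paths between x_l and x_k

  record Via (l k : Fin m) (u y : V n m) (es : List (Seg n m)) : Set where
    field
      before middle after : List (Seg n m)
      split       : es ≡ before ++ middle ++ after
      walk-before : Walk u (int l) before
      walk-middle : Walk (int l) (int k) middle
      walk-after  : Walk (int k) y after

  via : ∀ {l k u y es} → toℕ l <ℕ toℕ k → Walk u y es → Visits es l → Visits es k → Via l k u y es
  via {l} {k} l<k P at-l at-k with split-at l P at-l
  ... | A , R , refl , PA , PR with split-at k PR (subst (0 <ℕ_) (entry-++-behind PA (s≤s l<k)) at-k)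
  ...   | B , C , refl , PB , PC = record
    { before = A ; middle = B ; after = C ; split = refl ; walk-before = PA ; walk-middle = PB ; walk-after = PC }

  entry-via-stop : ∀ {u A B C l k} → Walk u (int l) A → Walk (int l) (int k) B → toℕ l <ℕ toℕ k →
                   entry (A ++ B ++ C) k ≡ entry B k
  entry-via-stop PA PB l<k = trans (entry-++-behind PA (s≤s l<k)) (entry-++-stop PB (s≤s l<k))

  entry-via-beyond : ∀ {u A B C l k K} → Walk u (int l) A → Walk (int l) (int k) B → toℕ l <ℕ toℕ k →
                     toℕ k <ℕ toℕ K → entry (A ++ B ++ C) K ≡ entry C K
  entry-via-beyond PA PB l<k k<K = trans (entry-++-behind PA (s≤s (<-trans l<k k<K))) (entry-++-behind PB (s≤s k<K))

  count-via : ∀ {u y A B C l k} e → Walk u (int l) A → Walk (int l) (int k) B → Walk (int k) y C →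
              fromBool (memB e (A ++ B ++ C)) ≡ fromBool (memB e A) + (fromBool (memB e B) + fromBool (memB e C))
  count-via e PA PB PC = trans (count-++ e PA (walk-++ PB PC)) (cong (_ +_) (count-++ e PB PC))

  splice : ∀ {l k u y es u′ y′ es′} → Via l k u y es → Via l k u′ y′ es′ → List (Seg n m)
  splice P Q = Via.before P ++ Via.middle Q ++ Via.after P

  splice-walk : ∀ {l k u y es u′ y′ es′} (P : Via l k u y es) (Q : Via l k u′ y′ es′) → Walk u y (splice P Q)
  splice-walk P Q = walk-++ (Via.walk-before P) (walk-++ (Via.walk-middle Q) (Via.walk-after P))

  splice-at-k : ∀ {l k u y es u′ y′ es′} → toℕ l <ℕ toℕ k → (P : Via l k u y es) (Q : Via l k u′ y′ es′) →
                entry (splice P Q) k ≡ entry es′ k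
  splice-at-k {k = k} {es′ = es′} l<k P Q = begin
    entry (splice P Q) k                      ≡⟨ entry-via-stop P.walk-before Q.walk-middle l<k ⟩
    entry Q.middle k                          ≡⟨ entry-via-stop Q.walk-before Q.walk-middle l<k ⟨
    entry (Q.before ++ Q.middle ++ Q.after) k ≡⟨ cong (λ es → entry es k) Q.split ⟨
    entry es′ k                               ∎
    where
    open ≡-Reasoning
    module P = Via P
    module Q = Via Q

  splice-beyond : ∀ {l k u y es u′ y′ es′ K} → toℕ l <ℕ toℕ k → toℕ k <ℕ toℕ K →
                  (P : Via l k u y es) (Q : Via l k u′ y′ es′) →
                  entry (splice P Q) K ≡ entry es K
  splice-beyond {es = es} {K = K} l<k k<K P Q = begin
    entry (splice P Q) K                      ≡⟨ entry-via-beyond P.walk-before Q.walk-middle l<k k<K ⟩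
    entry P.after K                           ≡⟨ entry-via-beyond P.walk-before P.walk-middle l<k k<K ⟨
    entry (P.before ++ P.middle ++ P.after) K ≡⟨ cong (λ es → entry es K) P.split ⟨
    entry es K                                ∎
    where
    open ≡-Reasoning
    module P = Via P
    module Q = Via Q

  splice-count : ∀ {l k u y es u′ y′ es′} e (P : Via l k u y es) (Q : Via l k u′ y′ es′) →
                 fromBool (memB e (splice P Q)) + fromBool (memB e (splice Q P))
                 ≡ fromBool (memB e es) + fromBool (memB e es′)
  splice-count {es = es} {es′ = es′} e P Q = begin
    count (splice P Q) + count (splice Q P)
      ≡⟨ cong₂ _+_ (count-via e P.walk-before Q.walk-middle P.walk-after)
                   (count-via e Q.walk-before P.walk-middle Q.walk-after) ⟩
    (count P.before + (count Q.middle + count P.after)) + (count Q.before + (count P.middle + count Q.after))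
      ≡⟨ solve 6 (λ a b c d e f → (a :+ (e :+ c)) :+ (d :+ (b :+ f)) := (a :+ (b :+ c)) :+ (d :+ (e :+ f))) refl
               (count P.before) (count P.middle) (count P.after) (count Q.before) (count Q.middle) (count Q.after) ⟩
    (count P.before + (count P.middle + count P.after)) + (count Q.before + (count Q.middle + count Q.after))
      ≡⟨ cong₂ _+_ (trans (cong count P.split) (count-via e P.walk-before P.walk-middle P.walk-after))
                   (trans (cong count Q.split) (count-via e Q.walk-before Q.walk-middle Q.walk-after)) ⟨
    count es + count es′ ∎
    where
    open ≡-Reasoning
    module P = Via P
    module Q = Via Q
    count : List (Seg n m) → ℕ
    count = fromBool ∘ memB e

  weight : (Fin n → List (Seg n m)) → Fin m → ℕ
  weight π k = sum λ h → toℕ h * entry (π h) k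

  weight≤ : ∀ π k → weight π k ≤ n * (n * n)
  weight≤ π k = sum-≤ _ λ h → *-mono-≤ (<⇒≤ (toℕ<n h)) (entry≤n (π h) k)

  module Exchange (v : Permutation′ n) (π : Fin n → List (Seg n m)) (π-covers : InΠ v π)
                  {i j : Fin n} {l k : Fin m} (i<j : toℕ i <ℕ toℕ j) (inversion : Inverted (π i) (π j) k)
                  (l<k : toℕ l <ℕ toℕ k) (at-l : Meet (π i) (π j) l) where

    walk : ∀ h → Walk (src h) (snk (v ⟨$⟩ʳ h)) (π h)
    walk h = path⇒walk (proj₁ π-covers h)

    j-at-k : Visits (π j) k
    j-at-k = Inverted.visited inversion

    i-at-k : Visits (π i) k
    i-at-k = <-trans j-at-k (Inverted.q-below inversion)

    P : Via l k (src i) (snk (v ⟨$⟩ʳ i)) (π i)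
    P = via l<k (walk i) (proj₁ at-l) i-at-k

    Q : Via l k (src j) (snk (v ⟨$⟩ʳ j)) (π j)
    Q = via l<k (walk j) (proj₂ at-l) j-at-k

    i≢j : i ≢ j
    i≢j i≡j = <-irrefl (cong toℕ i≡j) i<j

    σ : Fin n → List (Seg n m)
    σ h with h ≟ i | h ≟ j
    ... | yes _ | _     = splice P Q
    ... | no _  | yes _ = splice Q P
    ... | no _  | no _  = π h

    σ-i : σ i ≡ splice P Q
    σ-i with i ≟ i
    ... | yes _  = refl
    ... | no i≢i = contradiction refl i≢i

    σ-j : σ j ≡ splice Q P
    σ-j with j ≟ i | j ≟ j
    ... | yes j≡i | _      = contradiction (sym j≡i) i≢j
    ... | no _    | yes _  = refl
    ... | no _    | no j≢j = contradiction refl j≢j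

    σ-other : ∀ h → h ≢ i → h ≢ j → π h ≡ σ h
    σ-other h h≢i h≢j with h ≟ i | h ≟ j
    ... | yes h≡i | _       = contradiction h≡i h≢i
    ... | no _    | yes h≡j = contradiction h≡j h≢j
    ... | no _    | no _    = refl

    σ-paths : ∀ h → PathFrom (src h) (v ⟨$⟩ʳ h) (σ h)
    σ-paths h with h ≟ i | h ≟ j
    ... | yes refl | _        = walk⇒path (splice-walk P Q)
    ... | no _     | yes refl = walk⇒path (splice-walk Q P)
    ... | no _     | no _     = proj₁ π-covers h

    σ-counts : ∀ e → countB (λ h → memB e (σ h)) ≡ countB (λ h → memB e (π h))
    σ-counts e = begin
      countB (λ h → memB e (σ h)) ≡⟨ countB≡sum (λ h → memB e (σ h)) ⟩
      sum (count ∘ σ)             ≡⟨ sum-exchange-≡ (count ∘ π) (count ∘ σ) i≢j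
                                        (λ h h≢i h≢j → cong count (σ-other h h≢i h≢j))
                                        (trans (cong₂ _+_ (cong count σ-i) (cong count σ-j)) (splice-count e P Q)) ⟩
      sum (count ∘ π)             ≡⟨ countB≡sum (λ h → memB e (π h)) ⟨
      countB (λ h → memB e (π h)) ∎
      where
      open ≡-Reasoning
      count : List (Seg n m) → ℕ
      count = fromBool ∘ memB e

    σ-covers : InΠ v σ
    σ-covers = σ-paths , λ e is-edge → trans (σ-counts e) (proj₂ π-covers e is-edge)

    σ-beyond : ∀ h K → toℕ k <ℕ toℕ K → entry (σ h) K ≡ entry (π h) K
    σ-beyond h K k<K with h ≟ i | h ≟ j
    ... | yes refl | _        = splice-beyond l<k k<K P Q
    ... | no _     | yes refl = splice-beyond l<k k<K Q P
    ... | no _     | no _     = refl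

    weight-increases : weight π k <ℕ weight σ k
    weight-increases =
      sum-exchange-< (λ h → toℕ h * entry (π h) k) (λ h → toℕ h * entry (σ h) k) i≢j
                     (λ h h≢i h≢j → cong (λ es → toℕ h * entry es k) (σ-other h h≢i h≢j))
                     (subst₂ (λ A B → toℕ i * entry (π i) k + toℕ j * entry (π j) k <ℕ toℕ i * A + toℕ j * B)
                             (sym (trans (cong (λ es → entry es k) σ-i) (splice-at-k l<k P Q)))
                             (sym (trans (cong (λ es → entry es k) σ-j) (splice-at-k l<k Q P)))
                             (rearrangement i<j (Inverted.q-below inversion)))

  record Untangled (v : Permutation′ n) (π : Fin n → List (Seg n m)) (k : Fin m) : Set where
    field
      σ             : Fin n → List (Seg n m)
      covers        : InΠ v σ
      agrees-beyond : ∀ h K → toℕ k <ℕ toℕ K → entry (σ h) K ≡ entry (π h) K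
      uninverted    : ∀ i j → toℕ i <ℕ toℕ j → ¬ Inverted (σ i) (σ j) k

  untangle : ∀ v π k → InΠ v π → Untangled v π k
  untangle v π₀ k covers₀ = go π₀ covers₀ (<-wellFounded (n * (n * n) ∸ weight π₀ k))
    where
    go : ∀ π → InΠ v π → Acc _<ℕ_ (n * (n * n) ∸ weight π k) → Untangled v π k
    go π covers (acc smaller) with any? (λ i → any? (λ j → toℕ i <? toℕ j ×-dec Inverted? (π i) (π j) k))
    ... | no none = record
      { σ = π ; covers = covers ; agrees-beyond = λ _ _ _ → refl
      ; uninverted = λ i j i<j inv → none (i , j , i<j , inv) }
    ... | yes (i , j , i<j , inv) with inverted⇒earlier-meeting k (proj₁ covers i) (proj₁ covers j) i<j inv
    ...   | l , l<k , at-l = record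
      { σ = U.σ ; covers = U.covers ; uninverted = U.uninverted
      ; agrees-beyond = λ h K k<K → trans (U.agrees-beyond h K k<K) (X.σ-beyond h K k<K) }
      where
      module X = Exchange v π covers i<j inv l<k at-l
      module U = Untangled (go X.σ X.σ-covers (smaller (∸-monoʳ-< X.weight-increases (weight≤ X.σ k))))

  Defect⇔Inverted : ∀ v π → InΠ v π → ∀ i j k → Defect π i j k ⇔ (toℕ i <ℕ toℕ j × Inverted (π i) (π j) k)
  Defect⇔Inverted _ _ (paths , _) i j k =
    mk⇔ (λ (i<j , scanned) → i<j , Equivalence.to (defect⇔inverted k (paths i) (paths j) i<j) scanned)
        (λ (i<j , inv) → i<j , Equivalence.from (defect⇔inverted k (paths i) (paths j) i<j) inv)

proposition4p8 : ∀ {n m} (a b : Fin m → ℕ) (T : Build m)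
    → (∀ j → IntervalIn n (a j) (b j))
    → (v : Permutation′ n) (π : Fin n → List (Seg n m))
    → Net.InΠ a b T v π
    → (k : Fin m)
    → ∃ λ (σ : Fin n → List (Seg n m))
    → Net.InΠ a b T v σ
    × (∀ p → k < p → ∀ i j → (Net.Defect a b T σ i j p ⇔ Net.Defect a b T π i j p))
    × (∀ i j → ¬ Net.Defect a b T σ i j k)
proposition4p8 a b T _ v π π-covers k = σ , covers , same-defects-beyond , no-defect-at-k
  -- the argument never uses that the intervals lie within [n]
  where
  open StarNetwork a b T
  open Untangled (untangle v π k π-covers)
  same-defects-beyond : ∀ p → k < p → ∀ i j → Net.Defect a b T σ i j p ⇔ Net.Defect a b T π i j p
  same-defects-beyond p k<p i j =
    ⇔-trans (Defect⇔Inverted v σ covers i j p)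
      (⇔-trans (⇔-refl ×-⇔ Inverted-cong (agrees-beyond i p k<p) (agrees-beyond j p k<p))
               (⇔-sym (Defect⇔Inverted v π π-covers i j p)))
  no-defect-at-k : ∀ i j → ¬ Net.Defect a b T σ i j k
  no-defect-at-k i j defect = let i<j , inv = Equivalence.to (Defect⇔Inverted v σ covers i j k) defect in uninverted i j i<j inv
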